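{- Let $k$ be a field of characteristic $0$ or of characteristic $>3$, let $j\in k$ with $j\neq 1728$, and let $v\in \bar k$ be a root of $\Phi_3(X,j)=(X+27)(X+3)^3-jX$ with $v^2+18v-27\neq 0$. Let $a=\frac{3j}{1728-j}$, $b=\frac{2j}{1728-j}$ and let $f_3(X)=3X^4+6aX^2+12bX-a^2$ be the $3$-division polynomial of the curve $E(j):Y^2=X^3+aX+b$. Then $$x_3=-\frac{(v+27)(v+3)}{v^2+18v-27}$$ is a root of $f_3(X)$.
   Context: The roots of the $3$-division polynomial $f_3$ are the abscissae of the nonzero $3$-torsion points of $E(j)$. -}

module Defs where

open import Level using (Level; _⊔_) renaming (suc to lsuc)
open import Data.Nat using (ℕ; zero; suc; _<_; _≤_)
open import Data.Product using (Σ; ∃; _×_; proj₁)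
open import Data.Sum using (_⊎_)
open import Relation.Nullary using (¬_)
open import Algebra.Bundles using (CommutativeRing)
import Algebra.Properties.Group as GroupProps

record Field (c ℓ : Level) : Set (lsuc (c ⊔ ℓ)) where
  field
    commutativeRing : CommutativeRing c ℓ
  open CommutativeRing commutativeRing public
  field
    1≉0 : ¬ (1# ≈ 0#)
    inverse : ∀ x → ¬ (x ≈ 0#) → ∃ λ y → x * y ≈ 1#

module FieldOps {c ℓ : Level} (F : Field c ℓ) where
  open Field F

  ⟦_⟧ : ℕ → Carrier
  ⟦ zero ⟧ = 0#
  ⟦ suc n ⟧ = 1# + ⟦ n ⟧

  _^2 : Carrier → Carrier
  x ^2 = x * x

  _^3 : Carrier → Carrier
  x ^3 = x * x * x

  _^4 : Carrier → Carrier
  x ^4 = x * x * x * x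

  inv : (x : Carrier) → ¬ (x ≈ 0#) → Carrier
  inv x x≉0 = proj₁ (inverse x x≉0)

  div : Carrier → (y : Carrier) → ¬ (y ≈ 0#) → Carrier
  div x y y≉0 = x * inv y y≉0

  -- F has characteristic p (p = 0 meaning characteristic zero)
  HasCharacteristic : ℕ → Set ℓ
  HasCharacteristic zero = ∀ n → 0 < n → ¬ (⟦ n ⟧ ≈ 0#)
  HasCharacteristic (suc p) =
    (⟦ suc p ⟧ ≈ 0#) × (∀ m → 0 < m → m < suc p → ¬ (⟦ m ⟧ ≈ 0#))

  Char0OrGt3 : Set ℓ
  Char0OrGt3 = HasCharacteristic 0 ⊎ Σ ℕ (λ p → (3 < p) × HasCharacteristic p)

  1728-j≉0 : (j : Carrier) → ¬ (j ≈ ⟦ 1728 ⟧) → ¬ ((⟦ 1728 ⟧ - j) ≈ 0#)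
  1728-j≉0 j j≉ h = j≉ (sym (GroupProps.x∙y⁻¹≈ε⇒x≈y +-group ⟦ 1728 ⟧ j h))

  coeffA : (j : Carrier) → ¬ (j ≈ ⟦ 1728 ⟧) → Carrier
  coeffA j hj = div (⟦ 3 ⟧ * j) (⟦ 1728 ⟧ - j) (1728-j≉0 j hj)

  coeffB : (j : Carrier) → ¬ (j ≈ ⟦ 1728 ⟧) → Carrier
  coeffB j hj = div (⟦ 2 ⟧ * j) (⟦ 1728 ⟧ - j) (1728-j≉0 j hj)

  Φ₃ : Carrier → Carrier → Carrier
  Φ₃ X j = (X + ⟦ 27 ⟧) * ((X + ⟦ 3 ⟧) ^3) - j * X

  f₃ : Carrier → Carrier → Carrier → Carrier
  f₃ a b X = ⟦ 3 ⟧ * (X ^4) + ⟦ 6 ⟧ * a * (X ^2) + ⟦ 12 ⟧ * b * X - a ^2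

  den : Carrier → Carrier
  den v = v ^2 + ⟦ 18 ⟧ * v - ⟦ 27 ⟧

  x₃ : (v : Carrier) → ¬ (den v ≈ 0#) → Carrier
  x₃ v hv = - div ((v + ⟦ 27 ⟧) * (v + ⟦ 3 ⟧)) (den v) hv

module Submission where

-- Clearing the denominators of a = 3j/(1728 - j), b = 2j/(1728 - j) and x₃ = -N/D, where
-- N = (v + 27)(v + 3) and D = v² + 18v - 27, turns (1728 - j)² D⁴ f₃(x₃) into a polynomial
-- in v and j of degree 2 in j. Dividing it by Φ₃(v, j), of degree 1 in j, leaves remainder 0,
-- so this numerator vanishes at every root v of Φ₃(X, j); the scaling factor is nonzero.
-- The identity holds over ℤ.

open import Defs
open import Level using (Level)
open import Function.Base using (_∘_)
open import Relation.Nullary using (¬_; yes; no)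
open import Algebra.Morphism.Structures using (IsRingHomomorphism)
open import Data.Nat.Base as ℕ using (ℕ; zero; suc)
import Data.Nat.Properties as ℕ
open import Data.Integer.Base as ℤ using (ℤ; +_; -[1+_]; _⊖_)
import Data.Integer.Properties as ℤ
open import Data.Maybe.Base using (Maybe; just; nothing)
open import Data.Product.Base using (proj₂)
import Relation.Binary.PropositionalEquality as ≡
open import Algebra.Bundles using (CommutativeRing)
open import Algebra.Solver.Ring.AlmostCommutativeRing
  using (fromCommutativeRing; _-Raw-AlmostCommutative⟶_)

module IntegerCoefficientRingSolver {c ℓ : Level} (R : CommutativeRing c ℓ) where
  open CommutativeRing R
  open import Algebra.Properties.Ring ring
    using (-0#≈0#; -‿involutive; -‿+-comm; -‿distribˡ-*; -‿distribʳ-*)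
  open import Algebra.Properties.Semiring.Mult semiring using (_×_; ×-homo-+; ×1-homo-*)
  open import Relation.Binary.Reasoning.Setoid setoid

  -- The numerals ⟦ n ⟧ of Defs are definitionally n × 1#, so the solver's constants
  -- fromℤ (+ n) match them without any rewriting.
  fromℤ : ℤ → Carrier
  fromℤ (+ n)    = n × 1#
  fromℤ -[1+ n ] = - (suc n × 1#)

  fromℤ-⊖ : ∀ m n → fromℤ (m ⊖ n) ≈ m × 1# - n × 1#
  fromℤ-⊖ m       zero    = sym (trans (+-congˡ -0#≈0#) (+-identityʳ _))
  fromℤ-⊖ zero    (suc n) = sym (+-identityˡ _)
  fromℤ-⊖ (suc m) (suc n) = begin
    fromℤ (suc m ⊖ suc n)         ≡⟨ ≡.cong fromℤ (ℤ.[1+m]⊖[1+n]≡m⊖n m n) ⟩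
    fromℤ (m ⊖ n)                 ≈⟨ fromℤ-⊖ m n ⟩
    x - y                         ≈⟨ +-congˡ (sym (+-identityˡ _)) ⟩
    x + (0# - y)                  ≈⟨ +-congˡ (+-congʳ (sym (-‿inverseʳ 1#))) ⟩
    x + ((1# - 1#) - y)           ≈⟨ +-congˡ (+-assoc _ _ _) ⟩
    x + (1# + (- 1# - y))         ≈⟨ sym (+-assoc _ _ _) ⟩
    (x + 1#) + (- 1# - y)         ≈⟨ +-cong (+-comm _ _) (-‿+-comm 1# y) ⟩
    (1# + x) - (1# + y)           ∎
    where
    x y : Carrier
    x = m × 1#
    y = n × 1#

  fromℤ-neg : ∀ i → fromℤ (ℤ.- i) ≈ - fromℤ i
  fromℤ-neg (+ zero)  = sym -0#≈0#
  fromℤ-neg (+ suc n) = refl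
  fromℤ-neg -[1+ n ]  = sym (-‿involutive _)

  fromℤ-+ : ∀ i j → fromℤ (i ℤ.+ j) ≈ fromℤ i + fromℤ j
  fromℤ-+ (+ m)    (+ n)    = ×-homo-+ 1# m n
  fromℤ-+ (+ m)    -[1+ n ] = fromℤ-⊖ m (suc n)
  fromℤ-+ -[1+ m ] (+ n)    = trans (fromℤ-⊖ n (suc m)) (+-comm _ _)
  fromℤ-+ -[1+ m ] -[1+ n ] = begin
    - (suc (suc (m ℕ.+ n)) × 1#)       ≡⟨ ≡.cong (λ k → - (k × 1#)) (ℕ.+-suc (suc m) n) ⟨
    - ((suc m ℕ.+ suc n) × 1#)         ≈⟨ -‿cong (×-homo-+ 1# (suc m) (suc n)) ⟩
    - (suc m × 1# + suc n × 1#)        ≈⟨ -‿+-comm _ _ ⟨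
    - (suc m × 1#) - suc n × 1#        ∎

  fromℤ-*-pos : ∀ m n → fromℤ (+ m ℤ.* + n) ≈ m × 1# * n × 1#
  fromℤ-*-pos m n = begin
    fromℤ (+ m ℤ.* + n)   ≡⟨ ≡.cong fromℤ (ℤ.pos-* m n) ⟨
    (m ℕ.* n) × 1#        ≈⟨ ×1-homo-* m n ⟩
    m × 1# * n × 1#       ∎

  fromℤ-* : ∀ i j → fromℤ (i ℤ.* j) ≈ fromℤ i * fromℤ j
  fromℤ-* (+ m)    (+ n)    = fromℤ-*-pos m n
  fromℤ-* (+ m)    -[1+ n ] = begin
    fromℤ (+ m ℤ.* ℤ.- + suc n)     ≡⟨ ≡.cong fromℤ (ℤ.neg-distribʳ-* (+ m) (+ suc n)) ⟨
    fromℤ (ℤ.- (+ m ℤ.* + suc n))   ≈⟨ fromℤ-neg (+ m ℤ.* + suc n) ⟩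
    - fromℤ (+ m ℤ.* + suc n)       ≈⟨ -‿cong (fromℤ-*-pos m (suc n)) ⟩
    - (m × 1# * suc n × 1#)         ≈⟨ -‿distribʳ-* _ _ ⟩
    m × 1# * - (suc n × 1#)         ∎
  fromℤ-* -[1+ m ] (+ n)    = begin
    fromℤ (ℤ.- + suc m ℤ.* + n)     ≡⟨ ≡.cong fromℤ (ℤ.neg-distribˡ-* (+ suc m) (+ n)) ⟨
    fromℤ (ℤ.- (+ suc m ℤ.* + n))   ≈⟨ fromℤ-neg (+ suc m ℤ.* + n) ⟩
    - fromℤ (+ suc m ℤ.* + n)       ≈⟨ -‿cong (fromℤ-*-pos (suc m) n) ⟩
    - (suc m × 1# * n × 1#)         ≈⟨ -‿distribˡ-* _ _ ⟩
    - (suc m × 1#) * n × 1#         ∎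
  fromℤ-* -[1+ m ] -[1+ n ] = begin
    fromℤ (+ suc m ℤ.* + suc n)           ≈⟨ fromℤ-*-pos (suc m) (suc n) ⟩
    suc m × 1# * suc n × 1#               ≈⟨ -‿involutive _ ⟨
    - - (suc m × 1# * suc n × 1#)         ≈⟨ -‿cong (-‿distribˡ-* _ _) ⟩
    - (- (suc m × 1#) * suc n × 1#)       ≈⟨ -‿distribʳ-* _ _ ⟩
    - (suc m × 1#) * - (suc n × 1#)       ∎

  fromℤ-morphism : ℤ.+-*-rawRing -Raw-AlmostCommutative⟶ fromCommutativeRing R
  fromℤ-morphism = record
    { ⟦_⟧    = fromℤ
    ; +-homo = fromℤ-+
    ; *-homo = fromℤ-*
    ; -‿homo = fromℤ-neg
    ; 0-homo = refl
    ; 1-homo = +-identityʳ 1#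
    }

  fromℤ-≟ : ∀ i j → Maybe (fromℤ i ≈ fromℤ j)
  fromℤ-≟ i j with i ℤ.≟ j
  ... | yes ≡.refl = just refl
  ... | no _       = nothing

  open import Algebra.Solver.Ring ℤ.+-*-rawRing (fromCommutativeRing R) fromℤ-morphism fromℤ-≟ public

module FieldProperties {c ℓ : Level} (F : Field c ℓ) where
  open Field F
  open FieldOps F
  open import Algebra.Properties.Ring ring using (-‿distribʳ-*)
  open import Relation.Binary.Reasoning.Setoid setoid

  x*y≈0⇒y≈0 : ∀ {x y} → ¬ x ≈ 0# → x * y ≈ 0# → y ≈ 0#
  x*y≈0⇒y≈0 {x} {y} x≉0 x*y≈0 = begin
    y              ≈⟨ *-identityˡ y ⟨
    1# * y         ≈⟨ *-congʳ (proj₂ (inverse x x≉0)) ⟨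
    (x * x⁻¹) * y  ≈⟨ *-congʳ (*-comm x x⁻¹) ⟩
    (x⁻¹ * x) * y  ≈⟨ *-assoc x⁻¹ x y ⟩
    x⁻¹ * (x * y)  ≈⟨ *-congˡ x*y≈0 ⟩
    x⁻¹ * 0#       ≈⟨ zeroʳ x⁻¹ ⟩
    0#             ∎
    where
    x⁻¹ : Carrier
    x⁻¹ = inv x x≉0

  x≉0∧y≉0⇒x*y≉0 : ∀ {x y} → ¬ x ≈ 0# → ¬ y ≈ 0# → ¬ x * y ≈ 0#
  x≉0∧y≉0⇒x*y≉0 x≉0 y≉0 = y≉0 ∘ x*y≈0⇒y≈0 x≉0

  y*[x/y]≈x : ∀ x y (y≉0 : ¬ y ≈ 0#) → y * div x y y≉0 ≈ x
  y*[x/y]≈x x y y≉0 = begin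
    y * (x * y⁻¹)  ≈⟨ *-assoc y x y⁻¹ ⟨
    (y * x) * y⁻¹  ≈⟨ *-congʳ (*-comm y x) ⟩
    (x * y) * y⁻¹  ≈⟨ *-assoc x y y⁻¹ ⟩
    x * (y * y⁻¹)  ≈⟨ *-congˡ (proj₂ (inverse y y≉0)) ⟩
    x * 1#         ≈⟨ *-identityʳ x ⟩
    x              ∎
    where
    y⁻¹ : Carrier
    y⁻¹ = inv y y≉0

  y*[-x/y]≈-x : ∀ x y (y≉0 : ¬ y ≈ 0#) → y * - div x y y≉0 ≈ - x
  y*[-x/y]≈-x x y y≉0 = trans (sym (-‿distribʳ-* y _)) (-‿cong (y*[x/y]≈x x y y≉0))

module ThreeDivisionPolynomial {c ℓ : Level} (K : Field c ℓ) where
  open Field K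
  open FieldOps K
  open FieldProperties K
  open IntegerCoefficientRingSolver commutativeRing
    using (Polynomial; solve; _:=_; con; _:+_; _:*_; _:-_; :-_)
  open import Relation.Binary.Reasoning.Setoid setoid

  f₃-numerator : Carrier → Carrier → Carrier → Carrier → Carrier → Carrier
  f₃-numerator s d A B X =
    ⟦ 3 ⟧ * (s ^2) * (X ^4) + ⟦ 6 ⟧ * s * (d ^2) * A * (X ^2)
      + ⟦ 12 ⟧ * s * (d ^3) * B * X - (d ^4) * (A ^2)

  f₃-numerator-cong : ∀ s d {A A′ B B′ X X′} → A ≈ A′ → B ≈ B′ → X ≈ X′ →
                      f₃-numerator s d A B X ≈ f₃-numerator s d A′ B′ X′
  f₃-numerator-cong s d A≈ B≈ X≈ =
    +-cong (+-cong (+-cong (*-congˡ (*-cong (*-cong (*-cong X≈ X≈) X≈) X≈))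
                           (*-cong (*-congˡ A≈) (*-cong X≈ X≈)))
                   (*-cong (*-congˡ B≈) X≈))
           (-‿cong (*-congˡ (*-cong A≈ A≈)))

  f₃-clear-denominators : ∀ s d a b x →
    ((s * (d ^2)) ^2) * f₃ a b x ≈ f₃-numerator s d (s * a) (s * b) (d * x)
  f₃-clear-denominators = solve 5 (λ s d a b x →
      let d² = d :* d
          x² = x :* x
          f₃′ = con (+ 3) :* (x² :* x :* x) :+ con (+ 6) :* a :* x² :+ con (+ 12) :* b :* x :- a :* a
          A = s :* a ; B = s :* b ; X = d :* x
      in (s :* d²) :* (s :* d²) :* f₃′
         := con (+ 3) :* (s :* s) :* (X :* X :* X :* X) :+ con (+ 6) :* s :* d² :* A :* (X :* X)
            :+ con (+ 12) :* s :* (d² :* d) :* B :* X :- (d² :* d :* d) :* (A :* A))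
    refl

  f₃-cofactor : Carrier → Carrier → Carrier
  f₃-cofactor v J =
    ⟦ 20736 ⟧ * (⟦ 432 ⟧ * ((v + ⟦ 27 ⟧) ^3 * (v + ⟦ 3 ⟧))
      - (v ^4 + ⟦ 48 ⟧ * (v ^3) + ⟦ 810 ⟧ * (v ^2) + ⟦ 5832 ⟧ * v + ⟦ 15309 ⟧) * J)

  f₃-numerator≈cofactor*Φ₃ : ∀ v J →
    f₃-numerator (⟦ 1728 ⟧ - J) (den v) (⟦ 3 ⟧ * J) (⟦ 2 ⟧ * J) (- ((v + ⟦ 27 ⟧) * (v + ⟦ 3 ⟧)))
      ≈ f₃-cofactor v J * Φ₃ v J
  f₃-numerator≈cofactor*Φ₃ = solve 2 (λ v J →
      let n : ℕ → Polynomial 2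
          n k = con (+ k)
          v² = v :* v
          s = n 1728 :- J
          d = v² :+ n 18 :* v :- n 27
          A = n 3 :* J ; B = n 2 :* J
          X = :- ((v :+ n 27) :* (v :+ n 3))
          v+27³ = (v :+ n 27) :* (v :+ n 27) :* (v :+ n 27)
          v+3³ = (v :+ n 3) :* (v :+ n 3) :* (v :+ n 3)
      in n 3 :* (s :* s) :* (X :* X :* X :* X) :+ n 6 :* s :* (d :* d) :* A :* (X :* X)
           :+ n 12 :* s :* (d :* d :* d) :* B :* X :- (d :* d :* d :* d) :* (A :* A)
         := n 20736 :* (n 432 :* (v+27³ :* (v :+ n 3))
              :- (v² :* v :* v :+ n 48 :* (v² :* v) :+ n 810 :* v² :+ n 5832 :* v :+ n 15309) :* J)
            :* ((v :+ n 27) :* v+3³ :- J :* v))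
    refl

  f₃[x₃]≈0 : ∀ J a b → ¬ (⟦ 1728 ⟧ - J) ≈ 0# →
             (⟦ 1728 ⟧ - J) * a ≈ ⟦ 3 ⟧ * J → (⟦ 1728 ⟧ - J) * b ≈ ⟦ 2 ⟧ * J →
             ∀ v → Φ₃ v J ≈ 0# → (d≉0 : ¬ den v ≈ 0#) → f₃ a b (x₃ v d≉0) ≈ 0#
  f₃[x₃]≈0 J a b s≉0 s*a≈3J s*b≈2J v Φ₃≈0 d≉0 = x*y≈0⇒y≈0 scale≉0 (begin
    (s * (d ^2)) ^2 * f₃ a b x        ≈⟨ f₃-clear-denominators s d a b x ⟩
    f₃-numerator s d (s * a) (s * b) (d * x)
      ≈⟨ f₃-numerator-cong s d s*a≈3J s*b≈2J (y*[-x/y]≈-x _ d d≉0) ⟩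
    f₃-numerator s d (⟦ 3 ⟧ * J) (⟦ 2 ⟧ * J) (- ((v + ⟦ 27 ⟧) * (v + ⟦ 3 ⟧)))
      ≈⟨ f₃-numerator≈cofactor*Φ₃ v J ⟩
    f₃-cofactor v J * Φ₃ v J          ≈⟨ *-congˡ Φ₃≈0 ⟩
    f₃-cofactor v J * 0#              ≈⟨ zeroʳ _ ⟩
    0#                                ∎)
    where
    s d x : Carrier
    s = ⟦ 1728 ⟧ - J
    d = den v
    x = x₃ v d≉0
    s*d²≉0 : ¬ s * (d ^2) ≈ 0#
    s*d²≉0 = x≉0∧y≉0⇒x*y≉0 s≉0 (x≉0∧y≉0⇒x*y≉0 d≉0 d≉0)
    scale≉0 : ¬ (s * (d ^2)) ^2 ≈ 0#
    scale≉0 = x≉0∧y≉0⇒x*y≉0 s*d²≉0 s*d²≉0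

module FieldHomomorphism {c ℓ c′ ℓ′ : Level} (k : Field c ℓ) (K : Field c′ ℓ′)
    (ι : Field.Carrier k → Field.Carrier K)
    (ι-hom : IsRingHomomorphism (Field.rawRing k) (Field.rawRing K) ι) where
  private
    module k = Field k
    module k′ = FieldOps k
  open Field K hiding (zero)
  open FieldOps K
  open IsRingHomomorphism ι-hom
  open import Relation.Binary.Reasoning.Setoid setoid

  ι-⟦⟧ : ∀ n → ι k′.⟦ n ⟧ ≈ ⟦ n ⟧
  ι-⟦⟧ zero    = 0#-homo
  ι-⟦⟧ (suc n) = trans (+-homo k.1# k′.⟦ n ⟧) (+-cong 1#-homo (ι-⟦⟧ n))

  ι-⟦n⟧-x : ∀ n x → ι (k′.⟦ n ⟧ k.- x) ≈ ⟦ n ⟧ - ι x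
  ι-⟦n⟧-x n x = trans (+-homo k′.⟦ n ⟧ (k.- x)) (+-cong (ι-⟦⟧ n) (-‿homo x))

  ι-⟦n⟧*x : ∀ n x → ι (k′.⟦ n ⟧ k.* x) ≈ ⟦ n ⟧ * ι x
  ι-⟦n⟧*x n x = trans (*-homo k′.⟦ n ⟧ x) (*-congʳ (ι-⟦⟧ n))

  ι-y*[x/y] : ∀ x y (y≉0 : ¬ y k.≈ k.0#) → ι y * ι (k′.div x y y≉0) ≈ ι x
  ι-y*[x/y] x y y≉0 =
    trans (sym (*-homo y _)) (⟦⟧-cong (FieldProperties.y*[x/y]≈x k x y y≉0))

  ι-≉0 : ∀ {x} → ¬ x k.≈ k.0# → ¬ ι x ≈ 0#
  ι-≉0 {x} x≉0 ιx≈0 = 1≉0 (begin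
    1#               ≈⟨ 1#-homo ⟨
    ι k.1#           ≈⟨ ⟦⟧-cong (proj₂ (k.inverse x x≉0)) ⟨
    ι (x k.* x⁻¹)    ≈⟨ *-homo x x⁻¹ ⟩
    ι x * ι x⁻¹      ≈⟨ *-congʳ ιx≈0 ⟩
    0# * ι x⁻¹       ≈⟨ zeroˡ (ι x⁻¹) ⟩
    0#               ∎)
    where
    x⁻¹ : k.Carrier
    x⁻¹ = k′.inv x x≉0

lemma5p1 : ∀ {c ℓ c′ ℓ′ : Level} (k : Field c ℓ) (K : Field c′ ℓ′)
    (ι : Field.Carrier k → Field.Carrier K) →
    IsRingHomomorphism (Field.rawRing k) (Field.rawRing K) ι →
    FieldOps.Char0OrGt3 k →
    (j : Field.Carrier k) (hj : ¬ (Field._≈_ k j (FieldOps.⟦_⟧ k 1728))) →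
    (v : Field.Carrier K) →
    Field._≈_ K (FieldOps.Φ₃ K v (ι j)) (Field.0# K) →
    (hv : ¬ (Field._≈_ K (FieldOps.den K v) (Field.0# K))) →
    Field._≈_ K
      (FieldOps.f₃ K (ι (FieldOps.coeffA k j hj)) (ι (FieldOps.coeffB k j hj))
        (FieldOps.x₃ K v hv))
      (Field.0# K)
lemma5p1 k K ι ι-hom _ j hj v Φ₃≈0 hv =
  ThreeDivisionPolynomial.f₃[x₃]≈0 K (ι j) _ _ s≉0 (s*ι[n*j/s] 3) (s*ι[n*j/s] 2) v Φ₃≈0 hv
  where
  open Field K
  open FieldOps K
  open FieldHomomorphism k K ι ι-hom
  module k = Field k
  module k′ = FieldOps k

  s-hom : ι (k′.⟦ 1728 ⟧ k.- j) ≈ ⟦ 1728 ⟧ - ι j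
  s-hom = ι-⟦n⟧-x 1728 j

  s≉0 : ¬ ⟦ 1728 ⟧ - ι j ≈ 0#
  s≉0 = ι-≉0 (k′.1728-j≉0 j hj) ∘ trans s-hom

  s*ι[n*j/s] : ∀ n → (⟦ 1728 ⟧ - ι j) * ι (k′.div (k′.⟦ n ⟧ k.* j) _ (k′.1728-j≉0 j hj)) ≈ ⟦ n ⟧ * ι j
  s*ι[n*j/s] n = trans (*-congʳ (sym s-hom)) (trans (ι-y*[x/y] _ _ _) (ι-⟦n⟧*x n j))
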